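{- Let $G$ be a regular graph on $n$ vertices that is isomorphic neither to the edgeless graph $E_n$ nor to the complete graph $K_n$. Then for every $k$ with $2\le k\le n-2$, the token graph $F_k(G)$ is not regular.
   Context: All graphs are finite and simple; $E_n$ denotes the graph on $n$ vertices with no edges. For a graph $G=(V,E)$ on $n$ vertices and $1\le k<n$, the $k$-token graph $F_k(G)$ has as vertices the $k$-element subsets of $V$, with $A,B$ adjacent whenever $A\triangle B=\{a,b\}$ for some edge $ab$ of $G$. -}

module Defs where

open import Data.Nat using (ℕ; zero; suc)
open import Data.Bool using (Bool; true; false; _∧_; _xor_)
open import Data.Fin using (Fin)
open import Data.Fin.Subset using (Subset; ∣_∣; ⁅_⁆; _∪_)
open import Data.Vec using (Vec; []; _∷_; zipWith)
open import Data.Bool.ListAction using (any)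
open import Data.List using (List; []; _∷_; allFin; concatMap; map; _++_)
open import Data.Product using (Σ; ∃; ∃-syntax; _×_; _,_; proj₁)
open import Relation.Nullary using (¬_; does; yes; no)
open import Data.Empty using (⊥-elim)
open import Relation.Binary.PropositionalEquality using (_≡_)
open import Function.Bundles using (_⤖_; Bijection)
import Data.Vec.Properties as VecP
import Data.Bool.Properties as BoolP
import Data.Nat.Properties as NatP

record Graph (n : ℕ) : Set where
  field
    adj    : Fin n → Fin n → Bool
    sym    : ∀ u v → adj u v ≡ adj v u
    irrefl : ∀ v → adj v v ≡ false
open Graph public

E : (n : ℕ) → Graph n
E n = record { adj = λ _ _ → false ; sym = λ _ _ → _≡_.refl ; irrefl = λ _ → _≡_.refl }

neqBool : {n : ℕ} → Fin n → Fin n → Bool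
neqBool u v = Data.Bool.not (does (u Data.Fin.≟ v))

neqBool-sym : {n : ℕ} (u v : Fin n) → neqBool u v ≡ neqBool v u
neqBool-sym u v with u Data.Fin.≟ v | v Data.Fin.≟ u
... | yes _ | yes _ = _≡_.refl
... | no  _ | no  _ = _≡_.refl
... | yes p | no ¬q = ⊥-elim (¬q (Relation.Binary.PropositionalEquality.sym p))
... | no ¬p | yes q = ⊥-elim (¬p (Relation.Binary.PropositionalEquality.sym q))

neqBool-irrefl : {n : ℕ} (v : Fin n) → neqBool v v ≡ false
neqBool-irrefl v with v Data.Fin.≟ v
... | yes _ = _≡_.refl
... | no ¬p = ⊥-elim (¬p _≡_.refl)

K : (n : ℕ) → Graph n
K n = record { adj = neqBool ; sym = neqBool-sym ; irrefl = neqBool-irrefl }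

_≅_ : {n : ℕ} → Graph n → Graph n → Set
_≅_ {n} G H = Σ (Fin n ⤖ Fin n) λ f →
  ∀ u v → adj H (Bijection.to f u) (Bijection.to f v) ≡ adj G u v

count : {A : Set} → (A → Bool) → List A → ℕ
count p [] = 0
count p (x ∷ xs) with p x
... | true  = suc (count p xs)
... | false = count p xs

degree : {n : ℕ} → Graph n → Fin n → ℕ
degree {n} G v = count (adj G v) (allFin n)

Regular : {n : ℕ} → Graph n → Set
Regular {n} G = ∃[ d ] (∀ (v : Fin n) → degree G v ≡ d)

allSubsets : (n : ℕ) → List (Subset n)
allSubsets zero    = [] ∷ []
allSubsets (suc n) = map (false ∷_) (allSubsets n) ++ map (true ∷_) (allSubsets n)

_==_ : {n : ℕ} → Subset n → Subset n → Bool
A == B = does (VecP.≡-dec BoolP._≟_ A B)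

_△_ : {n : ℕ} → Subset n → Subset n → Subset n
A △ B = zipWith _xor_ A B

tokenAdj : {n : ℕ} → Graph n → Subset n → Subset n → Bool
tokenAdj {n} G A B =
  any (λ a → any (λ b → adj G a b ∧ ((A △ B) == (⁅ a ⁆ ∪ ⁅ b ⁆))) (allFin n)) (allFin n)

TokenVertex : (n k : ℕ) → Set
TokenVertex n k = Σ (Subset n) λ A → ∣ A ∣ ≡ k

tokenDegree : {n : ℕ} → Graph n → (k : ℕ) → TokenVertex n k → ℕ
tokenDegree {n} G k (A , _) =
  count (λ B → does (∣ B ∣ NatP.≟ k) ∧ tokenAdj G A B) (allSubsets n)

TokenRegular : {n : ℕ} → Graph n → ℕ → Set
TokenRegular {n} G k = ∃[ d ] (∀ (A : TokenVertex n k) → tokenDegree G k A ≡ d)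

module Submission where

-- A neighbour of a k-set A in F_k(G) is A with one token slid along an edge leaving A, and
-- every such slide gives a distinct neighbour; so the degree of A in F_k(G) is the number of
-- edges leaving A.  In a d-regular graph this number plus twice the number of edges inside A
-- is k·d, so if F_k(G) is regular all k-sets span the same number of edges.  Since G is neither
-- empty nor complete, some vertex x has a neighbour y and a non-neighbour z.  Fix w ∉ {y, z}
-- and a (k-2)-set T avoiding x, y, z, w: comparing the edges spanned by T ∪ {x, y} and
-- T ∪ {x, z} shows that z has one more neighbour in T than y, and then comparing
-- T ∪ {w, y} with T ∪ {w, z} shows that w is adjacent to y but not to z.  Hence every vertex
-- other than y is a non-neighbour of z, while x is a neighbour of y, so deg z < deg y.

open import Defs hiding (sym)
open import Data.Nat using (ℕ; _≤_; _∸_)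
open import Relation.Nullary using (¬_)

open import Data.Nat using (zero; suc; _+_; _*_; _<_; z≤n; s≤s)
open import Data.Nat.Properties
open import Data.Bool using (Bool; true; false; _∧_; _∨_; _xor_; not)
open import Data.Bool.Properties using (T-≡; T-∧; ∧-comm; ∧-assoc; xor-assoc; xor-same; ¬-not; not-¬)
open import Data.Fin using (Fin; zero; suc)
open import Data.Fin.Properties using (any?)
import Data.Fin.Properties as Finₚ
open import Data.Fin.Subset
  using (Subset; ∣_∣; ⁅_⁆; _∪_; _∩_; ∁; _∈_; _⊆_; Empty)
  renaming (⊥ to ∅)
open import Data.Fin.Subset.Properties
  using (x∈⁅x⁆; ⊥⊆; s⊆s; out⊆; p∩q⊆q; x∈⁅y⁆⇒x≡y; ∣⁅x⁆∣≡1; x∈p∪q⁺; x∈p∪q⁻; x∈p∩q⁺; x∈p∩q⁻; drop-∷-Empty;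
         ∣∁p∣≡n∸∣p∣; ∩-zeroʳ; ∣⊥∣≡0; ∩-distribˡ-∪; ∪-comm; x∈∁p⇒x∉p)
open import Data.Vec using ([]; _∷_; lookup; here)
open import Data.Vec.Properties using (∷-injectiveʳ; lookup-zipWith; lookup-map; ≡-dec; []=⇒lookup; lookup⇒[]=)
open import Data.List using (List; tabulate; allFin)
import Data.List as List
open import Data.List.Membership.Propositional using (lose)
open import Data.List.Membership.Propositional.Properties using (∈-allFin)
open import Data.List.Relation.Unary.Any using (satisfied)
open import Data.List.Relation.Unary.Any.Properties using (any⁺; any⁻)
open import Data.Product using (∃; ∃₂; _×_; _,_; proj₁; proj₂)
open import Data.Sum using (_⊎_; inj₁; inj₂)
open import Data.Empty using (⊥; ⊥-elim)
open import Function using (_∘_; Equivalence)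
open import Function.Construct.Identity using (⤖-id)
open import Relation.Nullary using (does; yes; no; contradiction)
open import Relation.Nullary.Decidable using (dec-true; dec-false; decidable-stable; ¬?)
open import Relation.Binary.PropositionalEquality
  using (_≡_; _≢_; refl; sym; trans; cong; cong₂; subst; subst₂; module ≡-Reasoning)
open import Data.Nat.Tactic.RingSolver using (solve-∀)
open import Algebra.Properties.Semiring.Sum +-*-semiring
  using (sum; sum-syntax; sum-cong-≗; sum-replicate-zero; ∑-distrib-+; ∑-comm; *-distribˡ-sum; *-distribʳ-sum)

⟦_⟧ : Bool → ℕ
⟦ true ⟧  = 1
⟦ false ⟧ = 0

⟦∨⟧-disjoint : ∀ x y w → x ∧ y ≡ false → ⟦ (x ∨ y) ∧ w ⟧ ≡ ⟦ x ∧ w ⟧ + ⟦ y ∧ w ⟧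
⟦∨⟧-disjoint true  false w _ = sym (+-identityʳ ⟦ w ⟧)
⟦∨⟧-disjoint false y     w _ = refl

∧-exchange : ∀ x y z → x ∧ y ∧ z ≡ y ∧ x ∧ z
∧-exchange x y z = trans (sym (∧-assoc x y z)) (trans (cong (_∧ z) (∧-comm x y)) (∧-assoc y x z))

⟦∧⟧-split : ∀ x y z → ⟦ x ∧ y ∧ z ⟧ + ⟦ x ∧ not y ∧ z ⟧ ≡ ⟦ x ⟧ * ⟦ z ⟧
⟦∧⟧-split false y     z = refl
⟦∧⟧-split true  true  z = refl
⟦∧⟧-split true  false z = sym (+-identityʳ ⟦ z ⟧)

⟦⟧-mono : ∀ {x y} → (x ≡ true → y ≡ true) → ⟦ x ⟧ ≤ ⟦ y ⟧
⟦⟧-mono {false} _   = z≤n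
⟦⟧-mono {true}  x⇒y rewrite x⇒y refl = ≤-refl

⟦⟧≡suc⟦⟧ : ∀ {s u} → ⟦ s ⟧ ≡ suc ⟦ u ⟧ → s ≡ true × u ≡ false
⟦⟧≡suc⟦⟧ {true} {false} _ = refl , refl

sum-zero : ∀ {n} {f : Fin n → ℕ} → (∀ i → f i ≡ 0) → sum f ≡ 0
sum-zero {n} f≗0 = trans (sum-cong-≗ f≗0) (sum-replicate-zero n)

sum-delta : ∀ {n} (f : Fin n → ℕ) j → (∀ i → i ≢ j → f i ≡ 0) → sum f ≡ f j
sum-delta f zero    f≗0 = trans (cong (f zero +_) (sum-zero (λ i → f≗0 (suc i) λ ()))) (+-identityʳ _)
sum-delta f (suc j) f≗0 =
  cong₂ _+_ (f≗0 zero λ ()) (sum-delta (f ∘ suc) j (λ i i≢j → f≗0 (suc i) (i≢j ∘ Finₚ.suc-injective)))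

sum-mono-≤ : ∀ {n} {f g : Fin n → ℕ} → (∀ i → f i ≤ g i) → sum f ≤ sum g
sum-mono-≤ {zero}  f≤g = z≤n
sum-mono-≤ {suc n} f≤g = +-mono-≤ (f≤g zero) (sum-mono-≤ (f≤g ∘ suc))

sum-mono-< : ∀ {n} {f g : Fin n → ℕ} → (∀ i → f i ≤ g i) → ∀ j → f j < g j → sum f < sum g
sum-mono-< f≤g zero    fj<gj = +-mono-<-≤ fj<gj (sum-mono-≤ (f≤g ∘ suc))
sum-mono-< f≤g (suc j) fj<gj = +-mono-≤-< (f≤g zero) (sum-mono-< (f≤g ∘ suc) j fj<gj)

count-tabulate : ∀ {A : Set} (p : A → Bool) {n} (f : Fin n → A) →
                 count p (tabulate f) ≡ ∑[ i < n ] ⟦ p (f i) ⟧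
count-tabulate p {zero}  f = refl
count-tabulate p {suc n} f with p (f zero)
... | true  = cong suc (count-tabulate p (f ∘ suc))
... | false = count-tabulate p (f ∘ suc)

lookup-∁ : ∀ {n} (A : Subset n) i → lookup (∁ A) i ≡ not (lookup A i)
lookup-∁ A i = lookup-map i not A

lookup-∪ : ∀ {n} (A B : Subset n) i → lookup (A ∪ B) i ≡ lookup A i ∨ lookup B i
lookup-∪ A B i = lookup-zipWith _∨_ i A B

lookup-∩ : ∀ {n} (A B : Subset n) i → lookup (A ∩ B) i ≡ lookup A i ∧ lookup B i
lookup-∩ A B i = lookup-zipWith _∧_ i A B

lookup-⁅x⁆ : ∀ {n} (u : Fin n) → lookup ⁅ u ⁆ u ≡ true
lookup-⁅x⁆ u = []=⇒lookup (x∈⁅x⁆ u)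

lookup-⁅y⁆ : ∀ {n} {i : Fin n} u → i ≢ u → lookup ⁅ u ⁆ i ≡ false
lookup-⁅y⁆ {i = i} u i≢u = ¬-not (i≢u ∘ x∈⁅y⁆⇒x≡y u ∘ lookup⇒[]= i ⁅ u ⁆)

∑-⁅⁆ : ∀ {n} (u : Fin n) (f : Fin n → ℕ) → ∑[ i < n ] (⟦ lookup ⁅ u ⁆ i ⟧ * f i) ≡ f u
∑-⁅⁆ u f = trans (sum-delta _ u λ i i≢u → cong (λ b → ⟦ b ⟧ * f i) (lookup-⁅y⁆ u i≢u))
                 (trans (cong (λ b → ⟦ b ⟧ * f u) (lookup-⁅x⁆ u)) (+-identityʳ (f u)))

Empty⇒lookup-∧ : ∀ {n} {A B : Subset n} → Empty (A ∩ B) → ∀ i → lookup A i ∧ lookup B i ≡ false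
Empty⇒lookup-∧ {A = A} {B} empty i =
  trans (sym (lookup-∩ A B i)) (¬-not λ i∈A∩B → empty (i , lookup⇒[]= i (A ∩ B) i∈A∩B))

Empty-∩-mono : ∀ {n} {A A′ B B′ : Subset n} → A′ ⊆ A → B′ ⊆ B → Empty (A ∩ B) → Empty (A′ ∩ B′)
Empty-∩-mono {A′ = A′} {B′ = B′} A′⊆A B′⊆B empty (i , i∈A′∩B′) =
  let i∈A′ , i∈B′ = x∈p∩q⁻ A′ B′ i∈A′∩B′ in empty (i , x∈p∩q⁺ (A′⊆A i∈A′ , B′⊆B i∈B′))

⁅⁆-disjoint : ∀ {n} {a b : Fin n} → a ≢ b → Empty (⁅ a ⁆ ∩ ⁅ b ⁆)
⁅⁆-disjoint {a = a} {b} a≢b (i , i∈a∩b) =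
  let i∈a , i∈b = x∈p∩q⁻ ⁅ a ⁆ ⁅ b ⁆ i∈a∩b in a≢b (trans (sym (x∈⁅y⁆⇒x≡y a i∈a)) (x∈⁅y⁆⇒x≡y b i∈b))

∈-pair⁻ : ∀ {n} {a b i : Fin n} → i ∈ ⁅ a ⁆ ∪ ⁅ b ⁆ → i ≡ a ⊎ i ≡ b
∈-pair⁻ {a = a} {b} i∈ with x∈p∪q⁻ ⁅ a ⁆ ⁅ b ⁆ i∈
... | inj₁ i∈a = inj₁ (x∈⁅y⁆⇒x≡y a i∈a)
... | inj₂ i∈b = inj₂ (x∈⁅y⁆⇒x≡y b i∈b)

==⇒≡ : ∀ {n} {A B : Subset n} → (A == B) ≡ true → A ≡ B
==⇒≡ {A = A} {B} A==B with ≡-dec Data.Bool._≟_ A B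
... | yes A≡B = A≡B

≡⇒== : ∀ {n} {A B : Subset n} → A ≡ B → (A == B) ≡ true
≡⇒== {A = A} {B} = dec-true (≡-dec Data.Bool._≟_ A B)

△-involutive : ∀ {n} (A B : Subset n) → A △ (A △ B) ≡ B
△-involutive []      []      = refl
△-involutive (x ∷ A) (y ∷ B) =
  cong₂ _∷_ (trans (sym (xor-assoc x x y)) (cong (_xor y) (xor-same x))) (△-involutive A B)

∣△∣ : ∀ {n} (A D : Subset n) → ∣ A △ D ∣ + ∣ A ∩ D ∣ ≡ ∣ A ∣ + ∣ ∁ A ∩ D ∣
∣△∣ []          []          = refl
∣△∣ (true ∷ A)  (true ∷ D)  = trans (+-suc _ _) (cong suc (∣△∣ A D))
∣△∣ (true ∷ A)  (false ∷ D) = cong suc (∣△∣ A D)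
∣△∣ (false ∷ A) (true ∷ D)  = trans (cong suc (∣△∣ A D)) (sym (+-suc _ _))
∣△∣ (false ∷ A) (false ∷ D) = ∣△∣ A D

∣∣-as-sum : ∀ {n} (A : Subset n) → ∣ A ∣ ≡ ∑[ i < n ] ⟦ lookup A i ⟧
∣∣-as-sum []          = refl
∣∣-as-sum (true ∷ A)  = cong suc (∣∣-as-sum A)
∣∣-as-sum (false ∷ A) = ∣∣-as-sum A

∣∩⁅⁆∣ : ∀ {n} (C : Subset n) a → ∣ C ∩ ⁅ a ⁆ ∣ ≡ ⟦ lookup C a ⟧
∣∩⁅⁆∣ {suc n} (true ∷ C)  zero    = cong suc (trans (cong ∣_∣ (∩-zeroʳ C)) (∣⊥∣≡0 n))
∣∩⁅⁆∣ {suc n} (false ∷ C) zero    = trans (cong ∣_∣ (∩-zeroʳ C)) (∣⊥∣≡0 n)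
∣∩⁅⁆∣ (true ∷ C)          (suc a) = ∣∩⁅⁆∣ C a
∣∩⁅⁆∣ (false ∷ C)         (suc a) = ∣∩⁅⁆∣ C a

∣∪∣-disjoint : ∀ {n} (A B : Subset n) → Empty (A ∩ B) → ∣ A ∪ B ∣ ≡ ∣ A ∣ + ∣ B ∣
∣∪∣-disjoint []          []          _     = refl
∣∪∣-disjoint (true ∷ A)  (true ∷ B)  empty = ⊥-elim (empty (zero , here))
∣∪∣-disjoint (true ∷ A)  (false ∷ B) empty = cong suc (∣∪∣-disjoint A B (drop-∷-Empty empty))
∣∪∣-disjoint (false ∷ A) (true ∷ B)  empty =
  trans (cong suc (∣∪∣-disjoint A B (drop-∷-Empty empty))) (sym (+-suc _ _))
∣∪∣-disjoint (false ∷ A) (false ∷ B) empty = ∣∪∣-disjoint A B (drop-∷-Empty empty)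

∣∪∣≤ : ∀ {n} (A B : Subset n) → ∣ A ∪ B ∣ ≤ ∣ A ∣ + ∣ B ∣
∣∪∣≤ []          []          = z≤n
∣∪∣≤ (true ∷ A)  (true ∷ B)  = s≤s (≤-trans (∣∪∣≤ A B) (+-monoʳ-≤ ∣ A ∣ (n≤1+n ∣ B ∣)))
∣∪∣≤ (true ∷ A)  (false ∷ B) = s≤s (∣∪∣≤ A B)
∣∪∣≤ (false ∷ A) (true ∷ B)  = subst (suc ∣ A ∪ B ∣ ≤_) (sym (+-suc ∣ A ∣ ∣ B ∣)) (s≤s (∣∪∣≤ A B))
∣∪∣≤ (false ∷ A) (false ∷ B) = ∣∪∣≤ A B

∣pair∣ : ∀ {n} {a b : Fin n} → a ≢ b → ∣ ⁅ a ⁆ ∪ ⁅ b ⁆ ∣ ≡ 2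
∣pair∣ {a = a} {b} a≢b = trans (∣∪∣-disjoint ⁅ a ⁆ ⁅ b ⁆ (⁅⁆-disjoint a≢b)) (cong₂ _+_ (∣⁅x⁆∣≡1 a) (∣⁅x⁆∣≡1 b))

∣∩pair∣ : ∀ {n} (C : Subset n) {a b} → a ≢ b → ∣ C ∩ (⁅ a ⁆ ∪ ⁅ b ⁆) ∣ ≡ ⟦ lookup C a ⟧ + ⟦ lookup C b ⟧
∣∩pair∣ C {a} {b} a≢b = begin
  ∣ C ∩ (⁅ a ⁆ ∪ ⁅ b ⁆) ∣             ≡⟨ cong ∣_∣ (∩-distribˡ-∪ C ⁅ a ⁆ ⁅ b ⁆) ⟩
  ∣ (C ∩ ⁅ a ⁆) ∪ (C ∩ ⁅ b ⁆) ∣       ≡⟨ ∣∪∣-disjoint (C ∩ ⁅ a ⁆) (C ∩ ⁅ b ⁆) disjoint ⟩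
  ∣ C ∩ ⁅ a ⁆ ∣ + ∣ C ∩ ⁅ b ⁆ ∣       ≡⟨ cong₂ _+_ (∣∩⁅⁆∣ C a) (∣∩⁅⁆∣ C b) ⟩
  ⟦ lookup C a ⟧ + ⟦ lookup C b ⟧     ∎
  where
  open ≡-Reasoning
  disjoint = Empty-∩-mono (p∩q⊆q C ⁅ a ⁆) (p∩q⊆q C ⁅ b ⁆) (⁅⁆-disjoint a≢b)

∣△-pair∣ : ∀ {n} {A B : Subset n} {a b} → a ≢ b → A △ B ≡ ⁅ a ⁆ ∪ ⁅ b ⁆ →
  ∣ B ∣ + (⟦ lookup A a ⟧ + ⟦ lookup A b ⟧) ≡ ∣ A ∣ + (⟦ not (lookup A a) ⟧ + ⟦ not (lookup A b) ⟧)
∣△-pair∣ {A = A} {B} {a} {b} a≢b A△B≡D = begin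
  ∣ B ∣ + (⟦ lookup A a ⟧ + ⟦ lookup A b ⟧)
    ≡⟨ cong₂ _+_ (cong ∣_∣ (trans (sym (△-involutive A B)) (cong (A △_) A△B≡D))) (sym (∣∩pair∣ A a≢b)) ⟩
  ∣ A △ D ∣ + ∣ A ∩ D ∣
    ≡⟨ ∣△∣ A D ⟩
  ∣ A ∣ + ∣ ∁ A ∩ D ∣
    ≡⟨ cong (∣ A ∣ +_) (trans (∣∩pair∣ (∁ A) a≢b) (cong₂ (λ x y → ⟦ x ⟧ + ⟦ y ⟧) (lookup-∁ A a) (lookup-∁ A b))) ⟩
  ∣ A ∣ + (⟦ not (lookup A a) ⟧ + ⟦ not (lookup A b) ⟧)
    ∎
  where
  open ≡-Reasoning
  D = ⁅ a ⁆ ∪ ⁅ b ⁆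

pair⊆ : ∀ {n} {X : Subset n} {p q} → p ∈ X → q ∈ X → ⁅ p ⁆ ∪ ⁅ q ⁆ ⊆ X
pair⊆ {X = X} p∈X q∈X i∈ with ∈-pair⁻ i∈
... | inj₁ refl = p∈X
... | inj₂ refl = q∈X

∁-disjoint : ∀ {n} (X : Subset n) → Empty (∁ X ∩ X)
∁-disjoint X (i , i∈∁X∩X) = let i∈∁X , i∈X = x∈p∩q⁻ (∁ X) X i∈∁X∩X in x∈∁p⇒x∉p i∈∁X i∈X

∣⁅⁆∪∣≤ : ∀ {n} (u : Fin n) A → ∣ ⁅ u ⁆ ∪ A ∣ ≤ suc ∣ A ∣
∣⁅⁆∪∣≤ u A = subst (λ s → ∣ ⁅ u ⁆ ∪ A ∣ ≤ s + ∣ A ∣) (∣⁅x⁆∣≡1 u) (∣∪∣≤ ⁅ u ⁆ A)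

∃-⊆-of-size : ∀ {n} (U : Subset n) m → m ≤ ∣ U ∣ → ∃ λ T → T ⊆ U × ∣ T ∣ ≡ m
∃-⊆-of-size {n} U      zero    _        = ∅ , ⊥⊆ , ∣⊥∣≡0 n
∃-⊆-of-size (true ∷ U)  (suc m) (s≤s m≤) =
  let T , T⊆U , ∣T∣≡m = ∃-⊆-of-size U m m≤ in true ∷ T , s⊆s T⊆U , cong suc ∣T∣≡m
∃-⊆-of-size (false ∷ U) (suc m) m<       =
  let T , T⊆U , ∣T∣≡m = ∃-⊆-of-size U (suc m) m< in false ∷ T , out⊆ T⊆U , ∣T∣≡m

∑ˢ : ∀ {n} → (Subset n → ℕ) → ℕ
∑ˢ {zero}  f = f []
∑ˢ {suc n} f = ∑ˢ (f ∘ (false ∷_)) + ∑ˢ (f ∘ (true ∷_))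

count-++ : ∀ {A : Set} (p : A → Bool) (xs ys : List A) → count p (xs List.++ ys) ≡ count p xs + count p ys
count-++ p List.[]       ys = refl
count-++ p (x List.∷ xs) ys with p x
... | true  = cong suc (count-++ p xs ys)
... | false = count-++ p xs ys

count-map : ∀ {A B : Set} (p : B → Bool) (f : A → B) (xs : List A) → count p (List.map f xs) ≡ count (p ∘ f) xs
count-map p f List.[]       = refl
count-map p f (x List.∷ xs) with p (f x)
... | true  = cong suc (count-map p f xs)
... | false = count-map p f xs

count-allSubsets : ∀ {n} (p : Subset n → Bool) → count p (allSubsets n) ≡ ∑ˢ (⟦_⟧ ∘ p)
count-allSubsets {zero}  p with p []
... | true  = refl
... | false = refl
count-allSubsets {suc n} p = begin
  count p (List.map (false ∷_) (allSubsets n) List.++ List.map (true ∷_) (allSubsets n))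
    ≡⟨ count-++ p (List.map (false ∷_) (allSubsets n)) _ ⟩
  count p (List.map (false ∷_) (allSubsets n)) + count p (List.map (true ∷_) (allSubsets n))
    ≡⟨ cong₂ _+_ (count-map p (false ∷_) (allSubsets n)) (count-map p (true ∷_) (allSubsets n)) ⟩
  count (p ∘ (false ∷_)) (allSubsets n) + count (p ∘ (true ∷_)) (allSubsets n)
    ≡⟨ cong₂ _+_ (count-allSubsets (p ∘ (false ∷_))) (count-allSubsets (p ∘ (true ∷_))) ⟩
  ∑ˢ (⟦_⟧ ∘ p ∘ (false ∷_)) + ∑ˢ (⟦_⟧ ∘ p ∘ (true ∷_))
    ∎
  where open ≡-Reasoning

∑ˢ-cong : ∀ {n} {f g : Subset n → ℕ} → (∀ B → f B ≡ g B) → ∑ˢ f ≡ ∑ˢ g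
∑ˢ-cong {zero}  f≗g = f≗g []
∑ˢ-cong {suc n} f≗g = cong₂ _+_ (∑ˢ-cong (f≗g ∘ (false ∷_))) (∑ˢ-cong (f≗g ∘ (true ∷_)))

∑ˢ-zero : ∀ {n} {f : Subset n → ℕ} → (∀ B → f B ≡ 0) → ∑ˢ f ≡ 0
∑ˢ-zero {zero}  f≗0 = f≗0 []
∑ˢ-zero {suc n} f≗0 = cong₂ _+_ (∑ˢ-zero (f≗0 ∘ (false ∷_))) (∑ˢ-zero (f≗0 ∘ (true ∷_)))

∑ˢ-delta : ∀ {n} (f : Subset n → ℕ) C → (∀ B → B ≢ C → f B ≡ 0) → ∑ˢ f ≡ f C
∑ˢ-delta f []          f≗0 = refl
∑ˢ-delta f (false ∷ C) f≗0 = trans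
  (cong₂ _+_ (∑ˢ-delta (f ∘ (false ∷_)) C λ B B≢C → f≗0 (false ∷ B) (B≢C ∘ ∷-injectiveʳ))
             (∑ˢ-zero λ B → f≗0 (true ∷ B) λ ()))
  (+-identityʳ _)
∑ˢ-delta f (true ∷ C)  f≗0 =
  cong₂ _+_ (∑ˢ-zero λ B → f≗0 (false ∷ B) λ ())
            (∑ˢ-delta (f ∘ (true ∷_)) C λ B B≢C → f≗0 (true ∷ B) (B≢C ∘ ∷-injectiveʳ))

∑ˢ-∑-comm : ∀ {n m} (f : Subset n → Fin m → ℕ) → ∑ˢ (λ B → ∑[ i < m ] f B i) ≡ ∑[ i < m ] ∑ˢ (λ B → f B i)
∑ˢ-∑-comm {zero}  f = refl
∑ˢ-∑-comm {suc n} f = trans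
  (cong₂ _+_ (∑ˢ-∑-comm (f ∘ (false ∷_))) (∑ˢ-∑-comm (f ∘ (true ∷_))))
  (sym (∑-distrib-+ (λ i → ∑ˢ (λ B → f (false ∷ B) i)) (λ i → ∑ˢ (λ B → f (true ∷ B) i))))

∑ˢ-*ˡ : ∀ {n} c (f : Subset n → ℕ) → ∑ˢ (λ B → c * f B) ≡ c * ∑ˢ f
∑ˢ-*ˡ {zero}  c f = refl
∑ˢ-*ˡ {suc n} c f = trans
  (cong₂ _+_ (∑ˢ-*ˡ c (f ∘ (false ∷_))) (∑ˢ-*ˡ c (f ∘ (true ∷_))))
  (sym (*-distribˡ-+ c _ _))

∑ˢ-△ : ∀ {n} (A C : Subset n) → ∑ˢ (λ B → ⟦ (A △ B) == C ⟧) ≡ 1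
∑ˢ-△ A C = trans
  (∑ˢ-delta _ (A △ C) λ B B≢A△C →
    cong ⟦_⟧ (dec-false (≡-dec Data.Bool._≟_ (A △ B) C) λ A△B≡C →
      B≢A△C (trans (sym (△-involutive A B)) (cong (A △_) A△B≡C))))
  (cong ⟦_⟧ (≡⇒== (△-involutive A C)))

-- Counting edges between vertex sets

module _ {n : ℕ} (G : Graph n) where

  open ≡-Reasoning

  adj⇒≢ : ∀ {a b} → adj G a b ≡ true → a ≢ b
  adj⇒≢ {a} ab refl = not-¬ (irrefl G a) ab

  degree-as-sum : ∀ v → degree G v ≡ ∑[ b < n ] ⟦ adj G v b ⟧
  degree-as-sum v = count-tabulate (adj G v) (λ b → b)

  -- Counts ordered pairs, so every edge inside A is counted twice by edgesBetween A A.
  edgesBetween : Subset n → Subset n → ℕ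
  edgesBetween A B = ∑[ a < n ] ∑[ b < n ] ⟦ lookup A a ∧ lookup B b ∧ adj G a b ⟧

  edgesBetween-comm : ∀ A B → edgesBetween A B ≡ edgesBetween B A
  edgesBetween-comm A B = trans (∑-comm (λ a b → ⟦ lookup A a ∧ lookup B b ∧ adj G a b ⟧))
    (sum-cong-≗ λ b → sum-cong-≗ λ a → cong ⟦_⟧ (trans (∧-exchange (lookup A a) (lookup B b) _)
      (cong (λ e → lookup B b ∧ lookup A a ∧ e) (Graph.sym G a b))))

  edgesBetween-∪ˡ : ∀ {A A′} B → Empty (A ∩ A′) →
                    edgesBetween (A ∪ A′) B ≡ edgesBetween A B + edgesBetween A′ B
  edgesBetween-∪ˡ {A} {A′} B disjoint = begin
    edgesBetween (A ∪ A′) B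
      ≡⟨ sum-cong-≗ (λ a → sum-cong-≗ λ b →
           trans (cong (λ x → ⟦ x ∧ lookup B b ∧ adj G a b ⟧) (lookup-∪ A A′ a))
                 (⟦∨⟧-disjoint (lookup A a) (lookup A′ a) _ (Empty⇒lookup-∧ disjoint a))) ⟩
    ∑[ a < n ] ∑[ b < n ] (edge A a b + edge A′ a b)
      ≡⟨ sum-cong-≗ (λ a → ∑-distrib-+ (edge A a) (edge A′ a)) ⟩
    ∑[ a < n ] (∑[ b < n ] edge A a b + ∑[ b < n ] edge A′ a b)
      ≡⟨ ∑-distrib-+ (λ a → ∑[ b < n ] edge A a b) (λ a → ∑[ b < n ] edge A′ a b) ⟩
    edgesBetween A B + edgesBetween A′ B
      ∎
    where
    edge : Subset n → Fin n → Fin n → ℕ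
    edge X a b = ⟦ lookup X a ∧ lookup B b ∧ adj G a b ⟧

  edgesBetween-∪ʳ : ∀ A {B B′} → Empty (B ∩ B′) →
                    edgesBetween A (B ∪ B′) ≡ edgesBetween A B + edgesBetween A B′
  edgesBetween-∪ʳ A {B} {B′} disjoint = begin
    edgesBetween A (B ∪ B′)                ≡⟨ edgesBetween-comm A (B ∪ B′) ⟩
    edgesBetween (B ∪ B′) A                ≡⟨ edgesBetween-∪ˡ A disjoint ⟩
    edgesBetween B A + edgesBetween B′ A   ≡⟨ cong₂ _+_ (edgesBetween-comm B A) (edgesBetween-comm B′ A) ⟩
    edgesBetween A B + edgesBetween A B′   ∎

  edgesBetween-⁅⁆ : ∀ u v → edgesBetween ⁅ u ⁆ ⁅ v ⁆ ≡ ⟦ adj G u v ⟧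
  edgesBetween-⁅⁆ u v = begin
    edgesBetween ⁅ u ⁆ ⁅ v ⁆
      ≡⟨ sum-delta (λ a → ∑[ b < n ] ⟦ lookup ⁅ u ⁆ a ∧ lookup ⁅ v ⁆ b ∧ adj G a b ⟧) u
           (λ a a≢u → sum-zero λ b → cong (λ x → ⟦ x ∧ lookup ⁅ v ⁆ b ∧ adj G a b ⟧) (lookup-⁅y⁆ u a≢u)) ⟩
    ∑[ b < n ] ⟦ lookup ⁅ u ⁆ u ∧ lookup ⁅ v ⁆ b ∧ adj G u b ⟧
      ≡⟨ cong (λ x → ∑[ b < n ] ⟦ x ∧ lookup ⁅ v ⁆ b ∧ adj G u b ⟧) (lookup-⁅x⁆ u) ⟩
    ∑[ b < n ] ⟦ lookup ⁅ v ⁆ b ∧ adj G u b ⟧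
      ≡⟨ sum-delta _ v (λ b b≢v → cong (λ x → ⟦ x ∧ _ ⟧) (lookup-⁅y⁆ v b≢v)) ⟩
    ⟦ lookup ⁅ v ⁆ v ∧ adj G u v ⟧
      ≡⟨ cong (λ x → ⟦ x ∧ adj G u v ⟧) (lookup-⁅x⁆ v) ⟩
    ⟦ adj G u v ⟧
      ∎

  edgesBetween-∪-∪ : ∀ {A B} → Empty (A ∩ B) →
    edgesBetween (A ∪ B) (A ∪ B) ≡ edgesBetween A A + 2 * edgesBetween A B + edgesBetween B B
  edgesBetween-∪-∪ {A} {B} disjoint = begin
    edgesBetween (A ∪ B) (A ∪ B)
      ≡⟨ edgesBetween-∪ˡ (A ∪ B) disjoint ⟩
    edgesBetween A (A ∪ B) + edgesBetween B (A ∪ B)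
      ≡⟨ cong₂ _+_ (edgesBetween-∪ʳ A disjoint) (edgesBetween-∪ʳ B disjoint) ⟩
    (edgesBetween A A + edgesBetween A B) + (edgesBetween B A + edgesBetween B B)
      ≡⟨ cong (λ e → (edgesBetween A A + edgesBetween A B) + (e + edgesBetween B B)) (edgesBetween-comm B A) ⟩
    (edgesBetween A A + edgesBetween A B) + (edgesBetween A B + edgesBetween B B)
      ≡⟨ rearrange (edgesBetween A A) (edgesBetween A B) (edgesBetween B B) ⟩
    edgesBetween A A + 2 * edgesBetween A B + edgesBetween B B
      ∎
    where
    rearrange : ∀ x y z → (x + y) + (y + z) ≡ x + 2 * y + z
    rearrange = solve-∀

  edgesBetween-∁ : ∀ A B → edgesBetween A B + edgesBetween A (∁ B) ≡ ∑[ a < n ] (⟦ lookup A a ⟧ * degree G a)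
  edgesBetween-∁ A B = begin
    edgesBetween A B + edgesBetween A (∁ B)
      ≡⟨ sym (∑-distrib-+ (λ a → ∑[ b < n ] edge B a b) (λ a → ∑[ b < n ] edge (∁ B) a b)) ⟩
    ∑[ a < n ] (∑[ b < n ] edge B a b + ∑[ b < n ] edge (∁ B) a b)
      ≡⟨ sum-cong-≗ (λ a → sym (∑-distrib-+ (edge B a) (edge (∁ B) a))) ⟩
    ∑[ a < n ] ∑[ b < n ] (edge B a b + edge (∁ B) a b)
      ≡⟨ sum-cong-≗ (λ a → sum-cong-≗ λ b →
           trans (cong (λ x → ⟦ lookup A a ∧ lookup B b ∧ adj G a b ⟧ + ⟦ lookup A a ∧ x ∧ adj G a b ⟧) (lookup-∁ B b))
                 (⟦∧⟧-split (lookup A a) (lookup B b) (adj G a b))) ⟩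
    ∑[ a < n ] ∑[ b < n ] (⟦ lookup A a ⟧ * ⟦ adj G a b ⟧)
      ≡⟨ sum-cong-≗ (λ a → trans (sym (*-distribˡ-sum ⟦ lookup A a ⟧ (λ b → ⟦ adj G a b ⟧)))
                                  (cong (⟦ lookup A a ⟧ *_) (sym (degree-as-sum a)))) ⟩
    ∑[ a < n ] (⟦ lookup A a ⟧ * degree G a)
      ∎
    where
    edge : Subset n → Fin n → Fin n → ℕ
    edge X a b = ⟦ lookup A a ∧ lookup X b ∧ adj G a b ⟧

  edgesBetween-⁅⁆∪⁅⁆ : ∀ {p q} → p ≢ q → edgesBetween (⁅ p ⁆ ∪ ⁅ q ⁆) (⁅ p ⁆ ∪ ⁅ q ⁆) ≡ 2 * ⟦ adj G p q ⟧
  edgesBetween-⁅⁆∪⁅⁆ {p} {q} p≢q = begin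
    edgesBetween (⁅ p ⁆ ∪ ⁅ q ⁆) (⁅ p ⁆ ∪ ⁅ q ⁆)
      ≡⟨ edgesBetween-∪-∪ (⁅⁆-disjoint p≢q) ⟩
    edgesBetween ⁅ p ⁆ ⁅ p ⁆ + 2 * edgesBetween ⁅ p ⁆ ⁅ q ⁆ + edgesBetween ⁅ q ⁆ ⁅ q ⁆
      ≡⟨ cong₂ (λ x y → x + 2 * edgesBetween ⁅ p ⁆ ⁅ q ⁆ + y) (no-loop p) (no-loop q) ⟩
    2 * edgesBetween ⁅ p ⁆ ⁅ q ⁆ + 0
      ≡⟨ trans (+-identityʳ _) (cong (2 *_) (edgesBetween-⁅⁆ p q)) ⟩
    2 * ⟦ adj G p q ⟧
      ∎
    where
    no-loop : ∀ u → edgesBetween ⁅ u ⁆ ⁅ u ⁆ ≡ 0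
    no-loop u = trans (edgesBetween-⁅⁆ u u) (cong ⟦_⟧ (irrefl G u))

  edgesBetween-pair : ∀ T {p q} → p ≢ q → Empty (T ∩ (⁅ p ⁆ ∪ ⁅ q ⁆)) →
    edgesBetween (T ∪ (⁅ p ⁆ ∪ ⁅ q ⁆)) (T ∪ (⁅ p ⁆ ∪ ⁅ q ⁆))
      ≡ edgesBetween T T + 2 * (edgesBetween T ⁅ p ⁆ + edgesBetween T ⁅ q ⁆ + ⟦ adj G p q ⟧)
  edgesBetween-pair T {p} {q} p≢q disjoint = begin
    edgesBetween (T ∪ D) (T ∪ D)
      ≡⟨ edgesBetween-∪-∪ disjoint ⟩
    edgesBetween T T + 2 * edgesBetween T D + edgesBetween D D
      ≡⟨ cong₂ (λ x y → edgesBetween T T + 2 * x + y) (edgesBetween-∪ʳ T (⁅⁆-disjoint p≢q)) (edgesBetween-⁅⁆∪⁅⁆ p≢q) ⟩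
    edgesBetween T T + 2 * (edgesBetween T ⁅ p ⁆ + edgesBetween T ⁅ q ⁆) + 2 * ⟦ adj G p q ⟧
      ≡⟨ +-assoc (edgesBetween T T) _ _ ⟩
    edgesBetween T T + (2 * (edgesBetween T ⁅ p ⁆ + edgesBetween T ⁅ q ⁆) + 2 * ⟦ adj G p q ⟧)
      ≡⟨ cong (edgesBetween T T +_) (*-distribˡ-+ 2 (edgesBetween T ⁅ p ⁆ + edgesBetween T ⁅ q ⁆) ⟦ adj G p q ⟧) ⟨
    edgesBetween T T + 2 * (edgesBetween T ⁅ p ⁆ + edgesBetween T ⁅ q ⁆ + ⟦ adj G p q ⟧)
      ∎
    where D = ⁅ p ⁆ ∪ ⁅ q ⁆

  edgesBetween-regular : ∀ {d} → (∀ v → degree G v ≡ d) →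
                         ∀ A → edgesBetween A A + edgesBetween A (∁ A) ≡ ∣ A ∣ * d
  edgesBetween-regular {d} regular A = begin
    edgesBetween A A + edgesBetween A (∁ A)    ≡⟨ edgesBetween-∁ A A ⟩
    ∑[ a < n ] (⟦ lookup A a ⟧ * degree G a)   ≡⟨ sum-cong-≗ (λ a → cong (⟦ lookup A a ⟧ *_) (regular a)) ⟩
    ∑[ a < n ] (⟦ lookup A a ⟧ * d)            ≡⟨ sym (*-distribʳ-sum d (λ a → ⟦ lookup A a ⟧)) ⟩
    (∑[ a < n ] ⟦ lookup A a ⟧) * d            ≡⟨ cong (_* d) (sym (∣∣-as-sum A)) ⟩
    ∣ A ∣ * d                                  ∎

  -- Adding c = [yz] at position v makes the neighbourhoods of z and y comparable pointwise,
  -- also at the vertices y and z themselves.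
  degree-< : ∀ {x y z} → y ≢ z → x ≢ y → x ≢ z → adj G y x ≡ true → adj G z x ≡ false →
             (∀ w → w ≢ y → w ≢ z → adj G z w ≡ true → adj G y w ≡ true) → degree G z < degree G y
  degree-< {x} {y} {z} y≢z x≢y x≢z yx ¬zx dominated =
    +-cancelʳ-< c (degree G z) (degree G y) (subst₂ _<_ (weighted z) (weighted y) (sum-mono-< f≤f x fx<fx))
    where
    c = ⟦ adj G y z ⟧
    f : Fin n → Fin n → ℕ
    f v w = ⟦ adj G v w ⟧ + ⟦ lookup ⁅ v ⁆ w ⟧ * c
    weighted : ∀ v → ∑[ w < n ] f v w ≡ degree G v + c
    weighted v = trans (∑-distrib-+ (λ w → ⟦ adj G v w ⟧) (λ w → ⟦ lookup ⁅ v ⁆ w ⟧ * c))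
                       (cong₂ _+_ (sym (degree-as-sum v)) (∑-⁅⁆ v (λ _ → c)))
    f≤f : ∀ w → f z w ≤ f y w
    f≤f w with w Finₚ.≟ y | w Finₚ.≟ z
    ... | yes refl | _        rewrite lookup-⁅y⁆ z y≢z | lookup-⁅x⁆ w | irrefl G w | Graph.sym G z w = ≤-refl
    ... | no _     | yes refl rewrite lookup-⁅y⁆ y (y≢z ∘ sym) | lookup-⁅x⁆ w | irrefl G w = ≤-refl
    ... | no w≢y   | no w≢z   rewrite lookup-⁅y⁆ y w≢y | lookup-⁅y⁆ z w≢z =
      +-monoˡ-≤ 0 (⟦⟧-mono (dominated w w≢y w≢z))
    fx<fx : f z x < f y x
    fx<fx rewrite lookup-⁅y⁆ y x≢y | lookup-⁅y⁆ z x≢z | yx | ¬zx = s≤s z≤n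

-- Degrees in the token graph

module _ {n : ℕ} (G : Graph n) where

  open ≡-Reasoning

  record Slide (A B : Subset n) (a b : Fin n) : Set where
    field
      source : lookup A a ≡ true
      target : lookup A b ≡ false
      edge   : adj G a b ≡ true
      moved  : A △ B ≡ ⁅ a ⁆ ∪ ⁅ b ⁆

  -- The indicator of Slide A B a b, written as a product so that its factor not involving B
  -- comes out of the sum over all B.
  slideIndicator : Subset n → Subset n → Fin n → Fin n → ℕ
  slideIndicator A B a b = ⟦ lookup A a ∧ lookup (∁ A) b ∧ adj G a b ⟧ * ⟦ (A △ B) == (⁅ a ⁆ ∪ ⁅ b ⁆) ⟧

  slideIndicator-one : ∀ {A B a b} → Slide A B a b → slideIndicator A B a b ≡ 1
  slideIndicator-one {A} {B} {a} {b} s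
    rewrite lookup-∁ A b | Slide.source s | Slide.target s | Slide.edge s
    = trans (+-identityʳ _) (cong ⟦_⟧ (≡⇒== (Slide.moved s)))

  slideIndicator-zero : ∀ {A B a b} → ¬ Slide A B a b → slideIndicator A B a b ≡ 0
  slideIndicator-zero {A} {B} {a} {b} ¬s rewrite lookup-∁ A b
    with lookup A a in ea | lookup A b in eb | adj G a b in ab | (A △ B) == (⁅ a ⁆ ∪ ⁅ b ⁆) in moved
  ... | true  | false | true  | true  = ⊥-elim (¬s (record { source = ea ; target = eb ; edge = ab ; moved = ==⇒≡ moved }))
  ... | true  | false | true  | false = refl
  ... | true  | false | false | _     = refl
  ... | true  | true  | _     | _     = refl
  ... | false | _     | _     | _     = refl

  Slide-unique : ∀ {A B a b a′ b′} → Slide A B a b → Slide A B a′ b′ → a′ ≡ a × b′ ≡ b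
  Slide-unique {A} {B} {a} {b} {a′} {b′} s s′ = source-unique (pair⊆pair (x∈p∪q⁺ (inj₁ (x∈⁅x⁆ a′))))
                                              , target-unique (pair⊆pair (x∈p∪q⁺ (inj₂ (x∈⁅x⁆ b′))))
    where
    pair⊆pair : ∀ {i} → i ∈ ⁅ a′ ⁆ ∪ ⁅ b′ ⁆ → i ≡ a ⊎ i ≡ b
    pair⊆pair i∈ = ∈-pair⁻ (subst (_ ∈_) (trans (sym (Slide.moved s′)) (Slide.moved s)) i∈)
    source-unique : a′ ≡ a ⊎ a′ ≡ b → a′ ≡ a
    source-unique (inj₁ a′≡a) = a′≡a
    source-unique (inj₂ refl) = ⊥-elim (not-¬ (Slide.source s′) (Slide.target s))
    target-unique : b′ ≡ a ⊎ b′ ≡ b → b′ ≡ b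
    target-unique (inj₁ refl) = ⊥-elim (not-¬ (Slide.source s) (Slide.target s′))
    target-unique (inj₂ b′≡b) = b′≡b

  ∑slideIndicator-one : ∀ {A B a b} → Slide A B a b → ∑[ i < n ] ∑[ j < n ] slideIndicator A B i j ≡ 1
  ∑slideIndicator-one {A} {B} {a} {b} s = begin
    ∑[ i < n ] ∑[ j < n ] slideIndicator A B i j
      ≡⟨ sum-delta (λ i → ∑[ j < n ] slideIndicator A B i j) a
           (λ i i≢a → sum-zero λ j → slideIndicator-zero {A} {B} {i} {j} (i≢a ∘ proj₁ ∘ Slide-unique s)) ⟩
    ∑[ j < n ] slideIndicator A B a j
      ≡⟨ sum-delta (slideIndicator A B a) b (λ j j≢b → slideIndicator-zero {A} {B} {a} {j} (j≢b ∘ proj₂ ∘ Slide-unique s)) ⟩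
    slideIndicator A B a b
      ≡⟨ slideIndicator-one s ⟩
    1 ∎

  ∑slideIndicator-zero : ∀ {A B} → (∀ a b → ¬ Slide A B a b) → ∑[ i < n ] ∑[ j < n ] slideIndicator A B i j ≡ 0
  ∑slideIndicator-zero no-slide = sum-zero λ i → sum-zero λ j → slideIndicator-zero (no-slide i j)

  Slide⇒tokenAdj : ∀ {A B a b} → Slide A B a b → tokenAdj G A B ≡ true
  Slide⇒tokenAdj {A} {B} {a} {b} s = Equivalence.to T-≡
    (any⁺ _ (lose (∈-allFin a) (any⁺ _ (lose (∈-allFin b)
      (Equivalence.from T-∧ (Equivalence.from T-≡ (Slide.edge s) , Equivalence.from T-≡ (≡⇒== (Slide.moved s))))))))

  tokenAdj⇒edge : ∀ {A B} → tokenAdj G A B ≡ true → ∃₂ λ a b → adj G a b ≡ true × A △ B ≡ ⁅ a ⁆ ∪ ⁅ b ⁆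
  tokenAdj⇒edge {A} {B} adjacent =
    let a , any-b = satisfied (any⁻ _ (allFin n) (Equivalence.from T-≡ adjacent))
        b , both  = satisfied (any⁻ _ (allFin n) any-b)
        ab , moved = Equivalence.to T-∧ both
    in a , b , Equivalence.to T-≡ ab , ==⇒≡ (Equivalence.to T-≡ moved)

  Slide-∣∣ : ∀ {A B a b} → Slide A B a b → ∣ B ∣ ≡ ∣ A ∣
  Slide-∣∣ {A} {B} {a} {b} s = +-cancelʳ-≡ 1 ∣ B ∣ ∣ A ∣ size
    where
    size : ∣ B ∣ + 1 ≡ ∣ A ∣ + 1
    size with ∣△-pair∣ (adj⇒≢ G (Slide.edge s)) (Slide.moved s)
    ... | eq rewrite Slide.source s | Slide.target s = eq

  tokenAdj⇒Slide : ∀ {A B} → ∣ B ∣ ≡ ∣ A ∣ → tokenAdj G A B ≡ true → ∃₂ (Slide A B)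
  tokenAdj⇒Slide {A} {B} ∣B∣≡∣A∣ adjacent with tokenAdj⇒edge adjacent
  ... | a , b , ab , moved
    with lookup A a in ea | lookup A b in eb | ∣△-pair∣ {A = A} {B} {a} {b} (adj⇒≢ G ab) moved
  ... | true  | false | _    = a , b , record { source = ea ; target = eb ; edge = ab ; moved = moved }
  ... | false | true  | _    =
    b , a , record { source = eb ; target = ea ; edge = trans (Graph.sym G b a) ab ; moved = trans moved (∪-comm ⁅ a ⁆ ⁅ b ⁆) }
  ... | true  | true  | size = contradiction (+-cancelˡ-≡ ∣ A ∣ 2 0 (trans (cong (_+ 2) (sym ∣B∣≡∣A∣)) size)) λ ()
  ... | false | false | size = contradiction (+-cancelˡ-≡ ∣ A ∣ 0 2 (trans (cong (_+ 0) (sym ∣B∣≡∣A∣)) size)) λ ()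

  tokenAdj-as-slides : ∀ {A B} → ∣ B ∣ ≡ ∣ A ∣ → ⟦ tokenAdj G A B ⟧ ≡ ∑[ a < n ] ∑[ b < n ] slideIndicator A B a b
  tokenAdj-as-slides {A} {B} ∣B∣≡∣A∣ with tokenAdj G A B in adjacent
  ... | true  = let _ , _ , s = tokenAdj⇒Slide {A} {B} ∣B∣≡∣A∣ adjacent in sym (∑slideIndicator-one s)
  ... | false = sym (∑slideIndicator-zero {A} {B} λ _ _ s → not-¬ (Slide⇒tokenAdj s) adjacent)

  tokenNeighbour-as-slides : ∀ {k A} → ∣ A ∣ ≡ k → ∀ B →
    ⟦ does (∣ B ∣ ≟ k) ∧ tokenAdj G A B ⟧ ≡ ∑[ a < n ] ∑[ b < n ] slideIndicator A B a b
  tokenNeighbour-as-slides {k} {A} ∣A∣≡k B with ∣ B ∣ ≟ k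
  ... | yes ∣B∣≡k = trans (cong (λ c → ⟦ c ∧ tokenAdj G A B ⟧) (dec-true (∣ B ∣ ≟ k) ∣B∣≡k))
                          (tokenAdj-as-slides {A} {B} (trans ∣B∣≡k (sym ∣A∣≡k)))
  ... | no ∣B∣≢k  = trans (cong (λ c → ⟦ c ∧ tokenAdj G A B ⟧) (dec-false (∣ B ∣ ≟ k) ∣B∣≢k))
                          (sym (∑slideIndicator-zero {A} {B} λ _ _ s → ∣B∣≢k (trans (Slide-∣∣ s) ∣A∣≡k)))

  ∑ˢ-slideIndicator : ∀ A a b → ∑ˢ (λ B → slideIndicator A B a b) ≡ ⟦ lookup A a ∧ lookup (∁ A) b ∧ adj G a b ⟧
  ∑ˢ-slideIndicator A a b =
    trans (∑ˢ-*ˡ c (λ B → ⟦ (A △ B) == (⁅ a ⁆ ∪ ⁅ b ⁆) ⟧)) (trans (cong (c *_) (∑ˢ-△ A (⁅ a ⁆ ∪ ⁅ b ⁆))) (*-identityʳ c))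
    where c = ⟦ lookup A a ∧ lookup (∁ A) b ∧ adj G a b ⟧

  tokenDegree≡edgesBetween : ∀ k (A : TokenVertex n k) → tokenDegree G k A ≡ edgesBetween G (proj₁ A) (∁ (proj₁ A))
  tokenDegree≡edgesBetween k (A , ∣A∣≡k) = begin
    count (λ B → does (∣ B ∣ ≟ k) ∧ tokenAdj G A B) (allSubsets n)
      ≡⟨ count-allSubsets (λ B → does (∣ B ∣ ≟ k) ∧ tokenAdj G A B) ⟩
    ∑ˢ (λ B → ⟦ does (∣ B ∣ ≟ k) ∧ tokenAdj G A B ⟧)
      ≡⟨ ∑ˢ-cong (tokenNeighbour-as-slides {k} {A} ∣A∣≡k) ⟩
    ∑ˢ (λ B → ∑[ a < n ] ∑[ b < n ] slideIndicator A B a b)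
      ≡⟨ ∑ˢ-∑-comm (λ B a → ∑[ b < n ] slideIndicator A B a b) ⟩
    ∑[ a < n ] ∑ˢ (λ B → ∑[ b < n ] slideIndicator A B a b)
      ≡⟨ sum-cong-≗ (λ a → trans (∑ˢ-∑-comm (λ B b → slideIndicator A B a b)) (sum-cong-≗ (∑ˢ-slideIndicator A a))) ⟩
    edgesBetween G A (∁ A)
      ∎

-- Regular graphs with a regular token graph

indicators-forced : ∀ a b c c′ s u → c + a + 1 ≡ c + b + 0 → c′ + a + ⟦ s ⟧ ≡ c′ + b + ⟦ u ⟧ →
                    s ≡ true × u ≡ false
indicators-forced a b c c′ s u eq₁ eq₂ = ⟦⟧≡suc⟦⟧ (+-cancelˡ-≡ a _ _ (begin
  a + ⟦ s ⟧          ≡⟨ cancel c′ ⟦ s ⟧ ⟦ u ⟧ eq₂ ⟩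
  b + ⟦ u ⟧          ≡⟨ cong (_+ ⟦ u ⟧) (sym (trans (cancel c 1 0 eq₁) (+-identityʳ b))) ⟩
  a + 1 + ⟦ u ⟧      ≡⟨ +-assoc a 1 ⟦ u ⟧ ⟩
  a + suc ⟦ u ⟧      ∎))
  where
  open ≡-Reasoning
  cancel : ∀ c x y → c + a + x ≡ c + b + y → a + x ≡ b + y
  cancel c x y eq = +-cancelˡ-≡ c _ _ (trans (sym (+-assoc c a x)) (trans eq (+-assoc c b y)))

module _ {n : ℕ} (G : Graph n) {k d c : ℕ} (regular : ∀ v → degree G v ≡ d)
         (tokenRegular : ∀ A → tokenDegree G k A ≡ c) where

  open ≡-Reasoning

  edgesBetween-self-constant : ∀ A A′ → ∣ A ∣ ≡ k → ∣ A′ ∣ ≡ k → edgesBetween G A A ≡ edgesBetween G A′ A′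
  edgesBetween-self-constant A A′ ∣A∣≡k ∣A′∣≡k = +-cancelʳ-≡ c _ _ (begin
    edgesBetween G A A + c                          ≡⟨ cong (_ +_) (sym (leaving A ∣A∣≡k)) ⟩
    edgesBetween G A A + edgesBetween G A (∁ A)     ≡⟨ edgesBetween-regular G regular A ⟩
    ∣ A ∣ * d                                       ≡⟨ cong (_* d) (trans ∣A∣≡k (sym ∣A′∣≡k)) ⟩
    ∣ A′ ∣ * d                                      ≡⟨ sym (edgesBetween-regular G regular A′) ⟩
    edgesBetween G A′ A′ + edgesBetween G A′ (∁ A′) ≡⟨ cong (_ +_) (leaving A′ ∣A′∣≡k) ⟩
    edgesBetween G A′ A′ + c                        ∎)
    where
    leaving : ∀ B (∣B∣≡k : ∣ B ∣ ≡ k) → edgesBetween G B (∁ B) ≡ c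
    leaving B ∣B∣≡k = trans (sym (tokenDegree≡edgesBetween G k (B , ∣B∣≡k))) (tokenRegular (B , ∣B∣≡k))

  pairWeight : Subset n → Fin n → Fin n → ℕ
  pairWeight T p q = edgesBetween G T ⁅ p ⁆ + edgesBetween G T ⁅ q ⁆ + ⟦ adj G p q ⟧

  pairWeight-constant : ∀ T → ∣ T ∣ + 2 ≡ k → ∀ {p q q′} → p ≢ q → p ≢ q′ →
    Empty (T ∩ (⁅ p ⁆ ∪ ⁅ q ⁆)) → Empty (T ∩ (⁅ p ⁆ ∪ ⁅ q′ ⁆)) → pairWeight T p q ≡ pairWeight T p q′
  pairWeight-constant T ∣T∣+2≡k {p} {q} {q′} p≢q p≢q′ T∩pq T∩pq′ =
    *-cancelˡ-≡ _ _ 2 (+-cancelˡ-≡ (edgesBetween G T T) _ _ (begin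
      edgesBetween G T T + 2 * pairWeight T p q        ≡⟨ edgesBetween-pair G T p≢q T∩pq ⟨
      edgesBetween G (T ∪ (⁅ p ⁆ ∪ ⁅ q ⁆)) (T ∪ (⁅ p ⁆ ∪ ⁅ q ⁆))
        ≡⟨ edgesBetween-self-constant (T ∪ (⁅ p ⁆ ∪ ⁅ q ⁆)) (T ∪ (⁅ p ⁆ ∪ ⁅ q′ ⁆)) (size p≢q T∩pq) (size p≢q′ T∩pq′) ⟩
      edgesBetween G (T ∪ (⁅ p ⁆ ∪ ⁅ q′ ⁆)) (T ∪ (⁅ p ⁆ ∪ ⁅ q′ ⁆))
        ≡⟨ edgesBetween-pair G T p≢q′ T∩pq′ ⟩
      edgesBetween G T T + 2 * pairWeight T p q′       ∎))
    where
    size : ∀ {r} → p ≢ r → Empty (T ∩ (⁅ p ⁆ ∪ ⁅ r ⁆)) → ∣ T ∪ (⁅ p ⁆ ∪ ⁅ r ⁆) ∣ ≡ k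
    size p≢r T∩pr = trans (∣∪∣-disjoint T _ T∩pr) (trans (cong (∣ T ∣ +_) (∣pair∣ p≢r)) ∣T∣+2≡k)

  neighbour-forced : 2 ≤ k → k ≤ n ∸ 2 → ∀ {x y z w} → adj G x y ≡ true → adj G x z ≡ false →
    x ≢ z → y ≢ w → z ≢ w → adj G w y ≡ true × adj G w z ≡ false
  neighbour-forced 2≤k k≤n∸2 {x} {y} {z} {w} xy ¬xz x≢z y≢w z≢w =
    indicators-forced (e y) (e z) (e x) (e w) (adj G w y) (adj G w z)
      (subst₂ (λ s u → e x + e y + ⟦ s ⟧ ≡ e x + e z + ⟦ u ⟧) xy ¬xz
              (pairWeight-constant T ∣T∣+2≡k (adj⇒≢ G xy) x≢z (avoids x∈X y∈X) (avoids x∈X z∈X)))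
      (pairWeight-constant T ∣T∣+2≡k (y≢w ∘ sym) (z≢w ∘ sym) (avoids w∈X y∈X) (avoids w∈X z∈X))
    where
    X = ⁅ x ⁆ ∪ ⁅ y ⁆ ∪ ⁅ z ⁆ ∪ ⁅ w ⁆
    x∈X : x ∈ X
    x∈X = x∈p∪q⁺ (inj₁ (x∈⁅x⁆ x))
    y∈X : y ∈ X
    y∈X = x∈p∪q⁺ (inj₂ (x∈p∪q⁺ (inj₁ (x∈⁅x⁆ y))))
    z∈X : z ∈ X
    z∈X = x∈p∪q⁺ (inj₂ (x∈p∪q⁺ (inj₂ (x∈p∪q⁺ (inj₁ (x∈⁅x⁆ z))))))
    w∈X : w ∈ X
    w∈X = x∈p∪q⁺ (inj₂ (x∈p∪q⁺ (inj₂ (x∈p∪q⁺ (inj₂ (x∈⁅x⁆ w))))))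
    ∣X∣≤4 : ∣ X ∣ ≤ 4
    ∣X∣≤4 = ≤-trans (∣⁅⁆∪∣≤ x _) (s≤s (≤-trans (∣⁅⁆∪∣≤ y _)
              (s≤s (≤-trans (∣⁅⁆∪∣≤ z _) (s≤s (≤-reflexive (∣⁅x⁆∣≡1 w)))))))
    room : k ∸ 2 ≤ ∣ ∁ X ∣
    room = ≤-trans (≤-trans (∸-monoˡ-≤ 2 k≤n∸2) (≤-reflexive (∸-+-assoc n 2 2)))
                   (≤-trans (∸-monoʳ-≤ n ∣X∣≤4) (≤-reflexive (sym (∣∁p∣≡n∸∣p∣ X))))
    T = proj₁ (∃-⊆-of-size (∁ X) (k ∸ 2) room)
    T⊆∁X = proj₁ (proj₂ (∃-⊆-of-size (∁ X) (k ∸ 2) room))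
    ∣T∣+2≡k : ∣ T ∣ + 2 ≡ k
    ∣T∣+2≡k = trans (cong (_+ 2) (proj₂ (proj₂ (∃-⊆-of-size (∁ X) (k ∸ 2) room)))) (m∸n+n≡m 2≤k)
    avoids : ∀ {p q} → p ∈ X → q ∈ X → Empty (T ∩ (⁅ p ⁆ ∪ ⁅ q ⁆))
    avoids p∈X q∈X = Empty-∩-mono T⊆∁X (pair⊆ p∈X q∈X) (∁-disjoint X)
    e : Fin n → ℕ
    e v = edgesBetween G T ⁅ v ⁆

  ¬neighbour-and-non-neighbour : 2 ≤ k → k ≤ n ∸ 2 →
    ∀ {x y z} → x ≢ z → adj G x y ≡ true → adj G x z ≡ false → ⊥
  ¬neighbour-and-non-neighbour 2≤k k≤n∸2 {x} {y} {z} x≢z xy ¬xz =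
    <-irrefl (trans (regular z) (sym (regular y))) (degree-< G y≢z (adj⇒≢ G xy) x≢z yx ¬zx dominated)
    where
    y≢z : y ≢ z
    y≢z refl = not-¬ xy ¬xz
    yx = trans (Graph.sym G y x) xy
    ¬zx = trans (Graph.sym G z x) ¬xz
    dominated : ∀ w → w ≢ y → w ≢ z → adj G z w ≡ true → adj G y w ≡ true
    dominated w w≢y w≢z zw = ⊥-elim (not-¬ (trans (Graph.sym G w z) zw)
      (proj₂ (neighbour-forced 2≤k k≤n∸2 xy ¬xz x≢z (w≢y ∘ sym) (w≢z ∘ sym))))

∃-edge : ∀ {n} (G : Graph n) → ¬ (G ≅ E n) → ∃₂ λ u v → adj G u v ≡ true
∃-edge {n} G G≇E with any? (λ u → any? (λ v → adj G u v Data.Bool.≟ true))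
... | yes (u , v , uv) = u , v , uv
... | no  ¬edge        = ⊥-elim (G≇E (⤖-id (Fin n) , λ u v → sym (¬-not λ uv → ¬edge (u , v , uv))))

∃-non-edge : ∀ {n} (G : Graph n) → ¬ (G ≅ K n) → ∃₂ λ u v → u ≢ v × adj G u v ≡ false
∃-non-edge {n} G G≇K with any? (λ u → any? (λ v → ¬? (adj G u v Data.Bool.≟ neqBool u v)))
... | no ¬differ = ⊥-elim (G≇K (⤖-id (Fin n) , λ u v →
    sym (decidable-stable (adj G u v Data.Bool.≟ neqBool u v) λ ne → ¬differ (u , v , ne))))
... | yes (u , v , differ) with u Finₚ.≟ v
...   | yes refl = ⊥-elim (differ (irrefl G u))
...   | no u≢v   = u , v , u≢v , ¬-not differ

∃-neighbour-and-non-neighbour : ∀ {n} (G : Graph n) → ¬ (G ≅ E n) → ¬ (G ≅ K n) →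
  ∃ λ x → ∃₂ λ y z → x ≢ z × adj G x y ≡ true × adj G x z ≡ false
∃-neighbour-and-non-neighbour G G≇E G≇K with ∃-edge G G≇E | ∃-non-edge G G≇K
... | u , v , uv | p , q , p≢q , ¬pq with u Finₚ.≟ p
...   | yes refl = u , v , q , p≢q , uv , ¬pq
...   | no u≢p with adj G u p in up
...     | true  = p , u , q , p≢q , trans (Graph.sym G p u) up , ¬pq
...     | false = u , v , p , u≢p , uv , up

theorem3 : (n : ℕ) (G : Graph n) → Regular G → ¬ (G ≅ E n) → ¬ (G ≅ K n) →
    (k : ℕ) → 2 ≤ k → k ≤ n ∸ 2 → ¬ TokenRegular G k
theorem3 n G (d , regular) G≇E G≇K k 2≤k k≤n∸2 (c , tokenRegular) =
  let x , y , z , x≢z , xy , ¬xz = ∃-neighbour-and-non-neighbour G G≇E G≇K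
  in ¬neighbour-and-non-neighbour G regular tokenRegular 2≤k k≤n∸2 x≢z xy ¬xz
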